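{- The system $\mathbf{MI}$ is complete with respect to each of the following classes: (1) descriptive I-frames; (2) I-frames; (3) intuitionistic Kripke frames. That is, if a formula $\phi$ is valid on every frame in the class, then $\phi \in \mathbf{MI}$.
   Context: Formulas: $\phi ::= \top \mid p \mid \phi\wedge\phi \mid \phi \to \phi$ with $p$ from a set of proposition letters. $\mathbf{MI}$ is the set of formulas derivable (from no assumptions) using modus ponens from all substitution instances of the axioms (H1) $p\to(q\to p)$; (H2) $(p\to(q\to r))\to((p\to q)\to(p\to r))$; (H3) $(p\wedge q)\to p$; (H4) $(p\wedge q)\to q$; (H5) $p\to(q\to(p\wedge q))$; (H6) $\top$. An intuitionistic Kripke frame is a poset $(X,\leq)$; a model adds a valuation assigning an up-closed set to each letter; $\top$ always holds, $p$ holds at $x$ iff $x \in V(p)$, $\wedge$ is pointwise, and $x \Vdash \phi\to\psi$ iff every $y \geq x$ with $y\Vdash\phi$ satisfies $y \Vdash \psi$. An I-frame is a poset $(X,\leq)$ that is an implicative meet-semilattice with top (there is $\to$ with $x \leq y\to z$ iff $x\wedge y\leq z$); I-models are I-frames with valuations assigning to each letter a filter (non-empty up-closed subset closed under finite meets), with the same satisfaction clauses. For filters $a,b$ let $a\Rightarrow b=\{x\mid \forall y\geq x,\ y\in a \Rightarrow y\in b\}$. A descriptive I-frame is $(X,\leq,A)$ with $(X,\leq)$ an I-frame and $A$ a set of filters closed under $\cap$ and $\Rightarrow$, differentiated (if $x\not\leq y$ some $a\in A$ contains $x$ but not $y$), and compact (every cover of $X$ by members of $A$ and their complements has a finite subcover);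 its models use valuations with values in $A$. A formula is valid on a frame if it holds at every point of every model based on that frame (of the appropriate kind). -}

module Defs where

open import Level using (Level; _⊔_; Lift; lift) renaming (suc to lsuc)
open import Data.Nat using (ℕ)
open import Data.Unit.Polymorphic using () renaming (⊤ to ⊤ℓ)
open import Data.Product using (Σ; ∃; _×_; _,_)
open import Data.Sum using (_⊎_; inj₁; inj₂)
open import Data.List using (List)
open import Data.List.Relation.Unary.All using (All)
open import Data.List.Relation.Unary.Any using (Any)
open import Relation.Nullary using (¬_)
open import Relation.Binary.Bundles using (Poset)
open import Relation.Binary.Lattice.Bundles using (BoundedMeetSemilattice)
open import Function.Bundles using (_⇔_)

infixr 6 _∧′_
infixr 5 _⇒_

data Fm : Set where
  ⊤′   : Fm
  var  : ℕ → Fm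
  _∧′_ : Fm → Fm → Fm
  _⇒_  : Fm → Fm → Fm

data MI : Fm → Set where
  H1 : ∀ p q → MI (p ⇒ (q ⇒ p))
  H2 : ∀ p q r → MI ((p ⇒ (q ⇒ r)) ⇒ ((p ⇒ q) ⇒ (p ⇒ r)))
  H3 : ∀ p q → MI ((p ∧′ q) ⇒ p)
  H4 : ∀ p q → MI ((p ∧′ q) ⇒ q)
  H5 : ∀ p q → MI (p ⇒ (q ⇒ (p ∧′ q)))
  H6 : MI ⊤′
  MP : ∀ {φ ψ} → MI (φ ⇒ ψ) → MI φ → MI ψ

module _ {c ℓ p : Level} {X : Set c} (_≤_ : X → X → Set ℓ)
         (V : ℕ → X → Set p) where

  Sat : X → Fm → Set (c ⊔ ℓ ⊔ p)
  Sat x ⊤′       = ⊤ℓ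
  Sat x (var n)  = Lift (c ⊔ ℓ) (V n x)
  Sat x (φ ∧′ ψ) = Sat x φ × Sat x ψ
  Sat x (φ ⇒ ψ)  = ∀ y → x ≤ y → Sat y φ → Sat y ψ

UpClosed : ∀ {c ℓ₁ ℓ₂ p} (P : Poset c ℓ₁ ℓ₂) → (Poset.Carrier P → Set p) → Set (c ⊔ ℓ₂ ⊔ p)
UpClosed P U = ∀ {x y} → x ≤ y → U x → U y
  where open Poset P

ValidKripkeFrame : ∀ {c ℓ₁ ℓ₂} (p : Level) → Poset c ℓ₁ ℓ₂ → Fm → Set (c ⊔ ℓ₂ ⊔ lsuc p)
ValidKripkeFrame p P φ =
  (V : ℕ → Poset.Carrier P → Set p) → (∀ n → UpClosed P (V n)) →
  ∀ x → Sat (Poset._≤_ P) V x φ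

ValidKripke : (c ℓ₁ ℓ₂ p : Level) → Fm → Set (lsuc (c ⊔ ℓ₁ ⊔ ℓ₂ ⊔ p))
ValidKripke c ℓ₁ ℓ₂ p φ = (P : Poset c ℓ₁ ℓ₂) → ValidKripkeFrame p P φ

record IFrame (c ℓ₁ ℓ₂ : Level) : Set (lsuc (c ⊔ ℓ₁ ⊔ ℓ₂)) where
  field
    bms : BoundedMeetSemilattice c ℓ₁ ℓ₂
  open BoundedMeetSemilattice bms public
  field
    _⇨_   : Carrier → Carrier → Carrier
    ⇨-adj : ∀ x y z → (x ≤ (y ⇨ z)) ⇔ ((x ∧ y) ≤ z)

record IsFilter {c ℓ₁ ℓ₂ p} (F : IFrame c ℓ₁ ℓ₂) (U : IFrame.Carrier F → Set p)
       : Set (c ⊔ ℓ₂ ⊔ p) where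
  open IFrame F
  field
    nonempty : ∃ λ x → U x
    upclosed : ∀ {x y} → x ≤ y → U x → U y
    meet     : ∀ {x y} → U x → U y → U (x ∧ y)

ValidIFrame : ∀ {c ℓ₁ ℓ₂} (p : Level) → IFrame c ℓ₁ ℓ₂ → Fm → Set (c ⊔ ℓ₂ ⊔ lsuc p)
ValidIFrame p F φ =
  (V : ℕ → IFrame.Carrier F → Set p) → (∀ n → IsFilter F (V n)) →
  ∀ x → Sat (IFrame._≤_ F) V x φ

ValidI : (c ℓ₁ ℓ₂ p : Level) → Fm → Set (lsuc (c ⊔ ℓ₁ ⊔ ℓ₂ ⊔ p))
ValidI c ℓ₁ ℓ₂ p φ = (F : IFrame c ℓ₁ ℓ₂) → ValidIFrame p F φ

-- Descriptive I-frames.  The set A of admissible filters is given as an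
-- indexed family  adm : Idx → (Carrier → Set p)  of filters.

inCov : ∀ {c p a} {X : Set c} {I : Set a} → (I → X → Set p) → X → I ⊎ I → Set p
inCov adm x (inj₁ i) = adm i x
inCov adm x (inj₂ i) = ¬ adm i x

record DescriptiveIFrame (c ℓ₁ ℓ₂ p a : Level) : Set (lsuc (c ⊔ ℓ₁ ⊔ ℓ₂ ⊔ p ⊔ a)) where
  field
    frame : IFrame c ℓ₁ ℓ₂
  open IFrame frame public
  field
    Idx      : Set a
    adm      : Idx → Carrier → Set p
    adm-filt : ∀ i → IsFilter frame (adm i)
    closed-∩ : ∀ i j → ∃ λ k → ∀ x → adm k x ⇔ (adm i x × adm j x)
    closed-⇒ : ∀ i j → ∃ λ k → ∀ x →
                 adm k x ⇔ (∀ y → x ≤ y → adm i y → adm j y)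
    differentiated : ∀ {x y} → ¬ (x ≤ y) → ∃ λ i → adm i x × ¬ adm i y

    -- compact: every cover (a collection S of members of A and complements
    -- of members of A whose union is X) has a finite subcover
    compact : (S : Idx ⊎ Idx → Set a) →
              (∀ x → ∃ λ u → S u × inCov adm x u) →
              ∃ λ (us : List (Idx ⊎ Idx)) → All S us × (∀ x → Any (inCov adm x) us)

ValidDescriptiveFrame : ∀ {c ℓ₁ ℓ₂ p a} → DescriptiveIFrame c ℓ₁ ℓ₂ p a → Fm →
                        Set (c ⊔ ℓ₂ ⊔ p ⊔ a)
ValidDescriptiveFrame D φ =
  (V : ℕ → Idx) → ∀ x → Sat _≤_ (λ n → adm (V n)) x φ
  where open DescriptiveIFrame D

ValidDescriptive : (c ℓ₁ ℓ₂ p a : Level) → Fm → Set (lsuc (c ⊔ ℓ₁ ⊔ ℓ₂ ⊔ p ⊔ a))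
ValidDescriptive c ℓ₁ ℓ₂ p a φ =
  (D : DescriptiveIFrame c ℓ₁ ℓ₂ p a) → ValidDescriptiveFrame D φ

-- A single finite model refutes every φ ∉ MI.  Fix the list S of subformulas of φ.  A point is
-- a finite family D of subsets of S, standing for the up-set ↑D it generates in the powerset;
-- D ≼ E means ↑E ⊆ ↑D.  These points form an implicative semilattice: meet is concatenation,
-- the top is the empty family, and D ⇨ E keeps the members of E outside ↑D.  Interpreting a
-- letter as the set of families all of whose members derive it, the truth lemma says that D
-- forces a subformula ψ iff every member of D derives ψ; at the family {∅} this is MI ⊢ ψ.
-- The same frame is descriptive once the admissible sets are taken to be the filters built from
-- principal up-sets and letters by ∩ and ⇛ (on any implicative semilattice, ⇛ of two filters is
-- again a filter); it has finitely many points up to equivalence, hence it is compact.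
module Submission where

open import Defs
open import Level using (Level; Lift; lift; lower; _⊔_; 0ℓ)
open import Data.Product using (_×_; _,_; ∃; proj₁; proj₂)
open import Data.Sum using (_⊎_; inj₁; inj₂)
open import Data.Nat using (ℕ; zero; suc)
open import Data.Bool using (true; false)
open import Data.Fin.Subset using (Subset; inside; outside; _⊆_) renaming (⊥ to ∅)
open import Data.Fin.Subset.Properties using (⊆-refl; ⊆-trans; _⊆?_; drop-∷-⊆; out⊆; in⊆in)
open import Data.Vec.Base using ([]; _∷_; here)
open import Data.List using (List; []; _∷_; _++_; map; length; filter)
open import Data.List.Relation.Unary.All as All using (All; []; _∷_)
open import Data.List.Relation.Unary.Any as Any using (Any; here; there)
import Data.List.Relation.Unary.All.Properties as All
import Data.List.Relation.Unary.Any.Properties as Any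
open import Data.List.Membership.Propositional using (_∈_; lose)
open import Data.List.Membership.Propositional.Properties
  using (∈-++⁺ˡ; ∈-++⁺ʳ; ∈-map⁺; ∈-filter⁺; ∈-filter⁻)
open import Data.List.Relation.Binary.Subset.Propositional using () renaming (_⊆_ to _⊆ₗ_)
open import Data.Unit.Polymorphic using (tt)
open import Function.Base using (_∘_; case_of_)
open import Function.Bundles using (_⇔_; mk⇔; Equivalence)
import Relation.Binary.PropositionalEquality as ≡
open import Relation.Nullary using (Dec; yes; no; does; ¬?)
open import Data.Empty using (⊥-elim)
open import Relation.Unary using (Decidable)

variable
  φ ψ χ : Fm

MI-K : MI φ → MI (ψ ⇒ φ)
MI-K {φ} {ψ} ⊢φ = MP (H1 φ ψ) ⊢φ

MI-S : MI (φ ⇒ ψ ⇒ χ) → MI (φ ⇒ ψ) → MI (φ ⇒ χ)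
MI-S {φ} {ψ} {χ} ⊢f ⊢g = MP (MP (H2 φ ψ χ) ⊢f) ⊢g

MI-refl : MI (φ ⇒ φ)
MI-refl {φ} = MI-S (H1 φ (φ ⇒ φ)) (H1 φ φ)

MI-trans : MI (φ ⇒ ψ) → MI (ψ ⇒ χ) → MI (φ ⇒ χ)
MI-trans ⊢f ⊢g = MI-S (MI-K ⊢g) ⊢f

MI-pair : MI (φ ⇒ ψ) → MI (φ ⇒ χ) → MI (φ ⇒ ψ ∧′ χ)
MI-pair ⊢f ⊢g = MI-S (MI-trans ⊢f (H5 _ _)) ⊢g

MI-curry : MI (φ ∧′ ψ ⇒ χ) → MI (φ ⇒ ψ ⇒ χ)
MI-curry {φ} {ψ} {χ} ⊢f = MI-trans (H5 φ ψ) (MP (H2 ψ (φ ∧′ ψ) χ) (MI-K ⊢f))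

module _ {c ℓ₁ ℓ₂ q : Level} (F : IFrame c ℓ₁ ℓ₂) where
  open IFrame F
  open IsFilter
  open Equivalence

  _⇛_ : (Carrier → Set q) → (Carrier → Set q) → Carrier → Set (c ⊔ ℓ₂ ⊔ q)
  (U ⇛ W) x = ∀ y → x ≤ y → U y → W y

  x∧y≤y∧x : ∀ x y → x ∧ y ≤ y ∧ x
  x∧y≤y∧x x y = ∧-greatest (x∧y≤y x y) (x∧y≤x x y)

  x≤y⇨x : ∀ x y → x ≤ y ⇨ x
  x≤y⇨x x y = from (⇨-adj x y x) (x∧y≤x x y)

  x∧[x⇨y]≤y : ∀ x y → x ∧ (x ⇨ y) ≤ y
  x∧[x⇨y]≤y x y = trans (x∧y≤y∧x x (x ⇨ y)) (to (⇨-adj (x ⇨ y) x y) refl)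

  ⊤∈filter : {U : Carrier → Set q} → IsFilter F U → U ⊤
  ⊤∈filter U-filter = let x , Ux = nonempty U-filter in upclosed U-filter (maximum x) Ux

  ∩-isFilter : {U W : Carrier → Set q} → IsFilter F U → IsFilter F W →
               IsFilter F (λ x → U x × W x)
  ∩-isFilter U-filter W-filter = record
    { nonempty = ⊤ , ⊤∈filter U-filter , ⊤∈filter W-filter
    ; upclosed = λ x≤y (Ux , Wx) → upclosed U-filter x≤y Ux , upclosed W-filter x≤y Wx
    ; meet     = λ (Ux , Wx) (Uy , Wy) → meet U-filter Ux Uy , meet W-filter Wx Wy
    }

  -- For the meet, with v = y ⇨ z and u = v ⇨ z: both lie in U (as z does), x ≤ v and y ≤ u,
  -- so v, u ∈ W, and v ∧ u ≤ z.
  ⇛-isFilter : {U W : Carrier → Set q} → IsFilter F U → IsFilter F W → IsFilter F (U ⇛ W)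
  ⇛-isFilter {U} {W} U-filter W-filter = record
    { nonempty = ⊤ , λ y ⊤≤y _ → upclosed W-filter ⊤≤y (⊤∈filter W-filter)
    ; upclosed = λ x≤x′ h y x′≤y → h y (trans x≤x′ x′≤y)
    ; meet     = ⇛-meet
    }
    where
    ⇛-meet : ∀ {x y} → (U ⇛ W) x → (U ⇛ W) y → (U ⇛ W) (x ∧ y)
    ⇛-meet {x} {y} hx hy z x∧y≤z Uz = upclosed W-filter (x∧[x⇨y]≤y v z) (meet W-filter Wv Wu)
      where
      v u : Carrier
      v = y ⇨ z
      u = v ⇨ z

      Wv : W v
      Wv = hx v (from (⇨-adj x y z) x∧y≤z) (upclosed U-filter (x≤y⇨x z y) Uz)

      Wu : W u
      Wu = hy u (from (⇨-adj y v z) (x∧[x⇨y]≤y y z)) (upclosed U-filter (x≤y⇨x z v) Uz)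

↑-isFilter : ∀ {c ℓ₁ ℓ₂} (F : IFrame c ℓ₁ ℓ₂) (x : IFrame.Carrier F) →
             IsFilter F (IFrame._≤_ F x)
↑-isFilter F x = record
  { nonempty = x , refl
  ; upclosed = λ y≤z x≤y → trans x≤y y≤z
  ; meet     = ∧-greatest
  }
  where open IFrame F

module _ {c ℓ₁ ℓ₂ p a : Level} (F : IFrame c ℓ₁ ℓ₂) {Idx : Set a}
         (adm : Idx → IFrame.Carrier F → Set p) where
  open IFrame F

  finite⇒compact :
    (∀ i {x y} → x ≤ y → adm i x → adm i y) →
    (reps : List Carrier) → (∀ x → Any (λ r → r ≤ x × x ≤ r) reps) →
    (S : Idx ⊎ Idx → Set a) → (∀ x → ∃ λ u → S u × inCov adm x u) →
    ∃ λ (us : List (Idx ⊎ Idx)) → All S us × (∀ x → Any (inCov adm x) us)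
  finite⇒compact adm-upclosed reps represented S cover =
      map (proj₁ ∘ cover) reps
    , All.map⁺ (All.universal (proj₁ ∘ proj₂ ∘ cover) reps)
    , λ x → Any.map⁺ (Any.map (λ {r} (r≤x , x≤r) → let u , _ , r∈u = cover r in
                                                      inCov-resp r≤x x≤r u r∈u)
                              (represented x))
    where
    inCov-resp : ∀ {r x} → r ≤ x → x ≤ r → ∀ u → inCov adm r u → inCov adm x u
    inCov-resp r≤x x≤r (inj₁ i) r∈i = adm-upclosed i r≤x r∈i
    inCov-resp r≤x x≤r (inj₂ i) r∉i = r∉i ∘ adm-upclosed i x≤r

liftIFrame : ∀ {c ℓ₁ ℓ₂} (c′ ℓ₁′ ℓ₂′ : Level) → IFrame c ℓ₁ ℓ₂ →
             IFrame (c ⊔ c′) (ℓ₁ ⊔ ℓ₁′) (ℓ₂ ⊔ ℓ₂′)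
liftIFrame c′ ℓ₁′ ℓ₂′ F = record
  { bms = record
    { Carrier = Lift c′ Carrier
    ; _≈_ = λ x y → Lift ℓ₁′ (lower x ≈ lower y)
    ; _≤_ = λ x y → Lift ℓ₂′ (lower x ≤ lower y)
    ; _∧_ = λ x y → lift (lower x ∧ lower y)
    ; ⊤ = lift ⊤
    ; isBoundedMeetSemilattice = record
      { isMeetSemilattice = record
        { isPartialOrder = record
          { isPreorder = record
            { isEquivalence = record
              { refl = lift Eq.refl
              ; sym = λ e → lift (Eq.sym (lower e))
              ; trans = λ e f → lift (Eq.trans (lower e) (lower f))
              }
            ; reflexive = λ e → lift (reflexive (lower e))
            ; trans = λ e f → lift (trans (lower e) (lower f))
            }
          ; antisym = λ e f → lift (antisym (lower e) (lower f))
          }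
        ; infimum = λ x y → lift (x∧y≤x _ _) , lift (x∧y≤y _ _) ,
                            λ z e f → lift (∧-greatest (lower e) (lower f))
        }
      ; maximum = λ x → lift (maximum (lower x))
      }
    }
  ; _⇨_ = λ x y → lift (lower x ⇨ lower y)
  ; ⇨-adj = λ x y z → mk⇔ (λ e → lift (to (⇨-adj _ _ _) (lower e)))
                          (λ e → lift (from (⇨-adj _ _ _) (lower e)))
  }
  where
  open IFrame F
  open Equivalence

lift-isFilter : ∀ {c ℓ₁ ℓ₂ q} {F : IFrame c ℓ₁ ℓ₂} {U : IFrame.Carrier F → Set q}
                {c′ ℓ₁′ ℓ₂′ : Level} (q′ : Level) → IsFilter F U →
                IsFilter (liftIFrame c′ ℓ₁′ ℓ₂′ F) (λ x → Lift q′ (U (lower x)))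
lift-isFilter q′ U-filter = record
  { nonempty = let x , Ux = nonempty in lift x , lift Ux
  ; upclosed = λ x≤y Ux → lift (upclosed (lower x≤y) (lower Ux))
  ; meet     = λ Ux Uy → lift (meet (lower Ux) (lower Uy))
  }
  where open IsFilter U-filter

module _ {c ℓ q : Level} {X : Set c} (_≤_ : X → X → Set ℓ) (V : ℕ → X → Set q)
         (c′ ℓ′ q′ : Level) where
  private
    _≤↑_ : Lift c′ X → Lift c′ X → Set (ℓ ⊔ ℓ′)
    x ≤↑ y = Lift ℓ′ (lower x ≤ lower y)

    V↑ : ℕ → Lift c′ X → Set (q ⊔ q′)
    V↑ n x = Lift q′ (V n (lower x))

  Sat-lower : ∀ {x} φ → Sat _≤↑_ V↑ (lift x) φ → Sat _≤_ V x φ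
  Sat-lift  : ∀ {x} φ → Sat _≤_ V x φ → Sat _≤↑_ V↑ (lift x) φ

  Sat-lower ⊤′       _             = tt
  Sat-lower (var n)  x⊩n           = lift (lower (lower x⊩n))
  Sat-lower (φ ∧′ ψ) (x⊩φ , x⊩ψ)   = Sat-lower φ x⊩φ , Sat-lower ψ x⊩ψ
  Sat-lower (φ ⇒ ψ)  x⊩φ⇒ψ y x≤y y⊩φ =
    Sat-lower ψ (x⊩φ⇒ψ (lift y) (lift x≤y) (Sat-lift φ y⊩φ))

  Sat-lift ⊤′       _             = tt
  Sat-lift (var n)  x⊩n           = lift (lift (lower x⊩n))
  Sat-lift (φ ∧′ ψ) (x⊩φ , x⊩ψ)   = Sat-lift φ x⊩φ , Sat-lift ψ x⊩ψ
  Sat-lift (φ ⇒ ψ)  x⊩φ⇒ψ y x≤y y⊩φ =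
    Sat-lift ψ (x⊩φ⇒ψ (lower y) (lower x≤y) (Sat-lower φ y⊩φ))

⋀ : (S : List Fm) → Subset (length S) → Fm
⋀ []      []            = ⊤′
⋀ (φ ∷ S) (inside ∷ Γ)  = φ ∧′ ⋀ S Γ
⋀ (φ ∷ S) (outside ∷ Γ) = ⋀ S Γ

⋀-antitone : (S : List Fm) {Γ Δ : Subset (length S)} → Γ ⊆ Δ → MI (⋀ S Δ ⇒ ⋀ S Γ)
⋀-antitone []      {[]}          {[]}          _   = MI-refl
⋀-antitone (φ ∷ S) {inside ∷ Γ}  {inside ∷ Δ}  Γ⊆Δ =
  MI-pair (H3 _ _) (MI-trans (H4 _ _) (⋀-antitone S (drop-∷-⊆ Γ⊆Δ)))
⋀-antitone (φ ∷ S) {inside ∷ Γ}  {outside ∷ Δ} Γ⊆Δ = case Γ⊆Δ here of λ ()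
⋀-antitone (φ ∷ S) {outside ∷ Γ} {inside ∷ Δ}  Γ⊆Δ =
  MI-trans (H4 _ _) (⋀-antitone S (drop-∷-⊆ Γ⊆Δ))
⋀-antitone (φ ∷ S) {outside ∷ Γ} {outside ∷ Δ} Γ⊆Δ = ⋀-antitone S (drop-∷-⊆ Γ⊆Δ)

⋀-∅ : (S : List Fm) → MI (⋀ S ∅)
⋀-∅ []      = H6
⋀-∅ (φ ∷ S) = ⋀-∅ S

insert : {S : List Fm} → ψ ∈ S → Subset (length S) → Subset (length S)
insert (here _)  (_ ∷ Γ) = inside ∷ Γ
insert (there m) (s ∷ Γ) = s ∷ insert m Γ

⊆-insert : {S : List Fm} (m : ψ ∈ S) (Γ : Subset (length S)) → Γ ⊆ insert m Γ
⊆-insert (here _)  (inside ∷ Γ)  = ⊆-refl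
⊆-insert (here _)  (outside ∷ Γ) = out⊆ ⊆-refl
⊆-insert (there m) (inside ∷ Γ)  = in⊆in (⊆-insert m Γ)
⊆-insert (there m) (outside ∷ Γ) = out⊆ (⊆-insert m Γ)

⋀-insert-proj : {S : List Fm} (m : ψ ∈ S) (Γ : Subset (length S)) → MI (⋀ S (insert m Γ) ⇒ ψ)
⋀-insert-proj (here ≡.refl) (_ ∷ Γ)       = H3 _ _
⋀-insert-proj (there m)     (inside ∷ Γ)  = MI-trans (H4 _ _) (⋀-insert-proj m Γ)
⋀-insert-proj (there m)     (outside ∷ Γ) = ⋀-insert-proj m Γ

⋀-insert-intro : {S : List Fm} (m : ψ ∈ S) (Γ : Subset (length S)) →
                 MI (⋀ S Γ ∧′ ψ ⇒ ⋀ S (insert m Γ))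
⋀-insert-intro (here ≡.refl) (inside ∷ Γ)  = H3 _ _
⋀-insert-intro (here ≡.refl) (outside ∷ Γ) = MI-pair (H4 _ _) (H3 _ _)
⋀-insert-intro (there m)     (inside ∷ Γ)  =
  MI-pair (MI-trans (H3 _ _) (H3 _ _))
          (MI-trans (MI-pair (MI-trans (H3 _ _) (H4 _ _)) (H4 _ _)) (⋀-insert-intro m Γ))
⋀-insert-intro (there m)     (outside ∷ Γ) = ⋀-insert-intro m Γ

-- The implicative semilattice of families of subsets of a finite set

Family : ℕ → Set
Family n = List (Subset n)

module _ {n : ℕ} where

  infix 4 _∈↑_ _≼_

  _∈↑_ : Subset n → Family n → Set
  Γ ∈↑ D = Any (_⊆ Γ) D

  _∈↑?_ : (Γ : Subset n) (D : Family n) → Dec (Γ ∈↑ D)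
  Γ ∈↑? D = Any.any? (_⊆? Γ) D

  _≼_ : Family n → Family n → Set
  D ≼ E = All (_∈↑ D) E

  ⊇⇒≼ : {D E : Family n} → E ⊆ₗ D → D ≼ E
  ⊇⇒≼ E⊆D = All.tabulate (λ Γ∈E → lose (E⊆D Γ∈E) ⊆-refl)

  ≼-refl : {D : Family n} → D ≼ D
  ≼-refl = ⊇⇒≼ (λ Γ∈D → Γ∈D)

  ∈↑-⊆ : {D : Family n} {Δ Γ : Subset n} → Δ ⊆ Γ → Δ ∈↑ D → Γ ∈↑ D
  ∈↑-⊆ Δ⊆Γ (here Δ′⊆Δ) = here (⊆-trans Δ′⊆Δ Δ⊆Γ)
  ∈↑-⊆ Δ⊆Γ (there Δ∈↑D) = there (∈↑-⊆ Δ⊆Γ Δ∈↑D)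

  ∈↑-All : {P : Subset n → Set} {D : Family n} {Γ : Subset n} →
           All P D → Γ ∈↑ D → ∃ λ Δ → P Δ × Δ ⊆ Γ
  ∈↑-All (PΔ ∷ _)  (here Δ⊆Γ)  = _ , PΔ , Δ⊆Γ
  ∈↑-All (_ ∷ PD)  (there Γ∈↑D) = ∈↑-All PD Γ∈↑D

  ∈↑-≼ : {D E : Family n} {Γ : Subset n} → D ≼ E → Γ ∈↑ E → Γ ∈↑ D
  ∈↑-≼ D≼E Γ∈↑E = let _ , Δ∈↑D , Δ⊆Γ = ∈↑-All D≼E Γ∈↑E in ∈↑-⊆ Δ⊆Γ Δ∈↑D

  ≼-trans : {D E F : Family n} → D ≼ E → E ≼ F → D ≼ F
  ≼-trans D≼E = All.map (∈↑-≼ D≼E)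

  _⇨ᶠ_ : Family n → Family n → Family n
  D ⇨ᶠ E = filter (λ Γ → ¬? (Γ ∈↑? D)) E

  ⇨ᶠ-adj : (F D E : Family n) → (F ≼ D ⇨ᶠ E) ⇔ (F ++ D ≼ E)
  ⇨ᶠ-adj F D E = mk⇔ to from
    where
    to : F ≼ D ⇨ᶠ E → F ++ D ≼ E
    to F≼D⇨E = All.tabulate λ {Γ} Γ∈E → case Γ ∈↑? D of λ where
      (yes Γ∈↑D) → Any.++⁺ʳ F Γ∈↑D
      (no Γ∉↑D)  → Any.++⁺ˡ (All.lookup F≼D⇨E (∈-filter⁺ _ Γ∈E Γ∉↑D))
    from : F ++ D ≼ E → F ≼ D ⇨ᶠ E
    from F++D≼E = All.tabulate λ Γ∈D⇨E →
      let Γ∈E , Γ∉↑D = ∈-filter⁻ _ {xs = E} Γ∈D⇨E in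
      case Any.++⁻ F (All.lookup F++D≼E Γ∈E) of λ where
        (inj₁ Γ∈↑F) → Γ∈↑F
        (inj₂ Γ∈↑D) → ⊥-elim (Γ∉↑D Γ∈↑D)

familyIFrame : ℕ → IFrame 0ℓ 0ℓ 0ℓ
familyIFrame n = record
  { bms = record
    { Carrier = Family n
    ; _≈_ = λ D E → D ≼ E × E ≼ D
    ; _≤_ = _≼_
    ; _∧_ = _++_
    ; ⊤ = []
    ; isBoundedMeetSemilattice = record
      { isMeetSemilattice = record
        { isPartialOrder = record
          { isPreorder = record
            { isEquivalence = record
              { refl = ≼-refl , ≼-refl
              ; sym = λ (D≼E , E≼D) → E≼D , D≼E
              ; trans = λ (D≼E , E≼D) (E≼F , F≼E) → ≼-trans D≼E E≼F , ≼-trans F≼E E≼D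
              }
            ; reflexive = proj₁
            ; trans = ≼-trans
            }
          ; antisym = _,_
          }
        ; infimum = λ D E → ⊇⇒≼ ∈-++⁺ˡ , ⊇⇒≼ (∈-++⁺ʳ D) , λ F → All.++⁺
        }
      ; maximum = λ D → []
      }
    }
  ; _⇨_ = _⇨ᶠ_
  ; ⇨-adj = ⇨ᶠ-adj
  }

allSubsets : (n : ℕ) → List (Subset n)
allSubsets zero    = [] ∷ []
allSubsets (suc n) = map (inside ∷_) (allSubsets n) ++ map (outside ∷_) (allSubsets n)

∈-allSubsets : {n : ℕ} (Γ : Subset n) → Γ ∈ allSubsets n
∈-allSubsets []            = here ≡.refl
∈-allSubsets (inside ∷ Γ)  = ∈-++⁺ˡ (∈-map⁺ (inside ∷_) (∈-allSubsets Γ))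
∈-allSubsets {suc n} (outside ∷ Γ) =
  ∈-++⁺ʳ (map (inside ∷_) (allSubsets n)) (∈-map⁺ (outside ∷_) (∈-allSubsets Γ))

sublists : {A : Set} → List A → List (List A)
sublists []       = [] ∷ []
sublists (x ∷ xs) = map (x ∷_) (sublists xs) ++ sublists xs

filter∈sublists : {A : Set} {P : A → Set} (P? : Decidable P) (xs : List A) →
                  filter P? xs ∈ sublists xs
filter∈sublists P? []       = here ≡.refl
filter∈sublists P? (x ∷ xs) with does (P? x)
... | true  = ∈-++⁺ˡ (∈-map⁺ (x ∷_) (filter∈sublists P? xs))
... | false = ∈-++⁺ʳ (map (x ∷_) (sublists xs)) (filter∈sublists P? xs)

-- D is equivalent to the list of all subsets in ↑D.
family-finite : {n : ℕ} (D : Family n) → Any (λ E → E ≼ D × D ≼ E) (sublists (allSubsets n))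
family-finite {n} D =
  Any.map (λ { ≡.refl → E≼D , D≼E }) (filter∈sublists (_∈↑? D) (allSubsets n))
  where
  E : Family n
  E = filter (_∈↑? D) (allSubsets n)

  E≼D : E ≼ D
  E≼D = All.tabulate λ {Γ} Γ∈D →
    lose (∈-filter⁺ (_∈↑? D) (∈-allSubsets Γ) (lose Γ∈D ⊆-refl)) ⊆-refl

  D≼E : D ≼ E
  D≼E = All.tabulate (λ Γ∈E → proj₂ (∈-filter⁻ (_∈↑? D) {xs = allSubsets n} Γ∈E))

-- The canonical model

subformulas : Fm → List Fm
subformulas ⊤′       = ⊤′ ∷ []
subformulas (var k)  = var k ∷ []
subformulas (φ ∧′ ψ) = (φ ∧′ ψ) ∷ subformulas φ ++ subformulas ψ
subformulas (φ ⇒ ψ)  = (φ ⇒ ψ) ∷ subformulas φ ++ subformulas ψ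

φ∈subformulas : (φ : Fm) → φ ∈ subformulas φ
φ∈subformulas ⊤′       = here ≡.refl
φ∈subformulas (var k)  = here ≡.refl
φ∈subformulas (φ ∧′ ψ) = here ≡.refl
φ∈subformulas (φ ⇒ ψ)  = here ≡.refl

module CanonicalModel (S : List Fm) where

  Derives : Fm → Family (length S) → Set
  Derives ψ D = All (λ Γ → MI (⋀ S Γ ⇒ ψ)) D

  Derives-isFilter : ∀ ψ → IsFilter (familyIFrame (length S)) (Derives ψ)
  Derives-isFilter ψ = record
    { nonempty = [] , []
    ; upclosed = λ D≼E D⊢ψ → All.map (λ Γ∈↑D →
        let _ , Δ⊢ψ , Δ⊆Γ = ∈↑-All D⊢ψ Γ∈↑D in MI-trans (⋀-antitone S Δ⊆Γ) Δ⊢ψ) D≼E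
    ; meet     = All.++⁺
    }

  Val : ℕ → Family (length S) → Set
  Val k = Derives (var k)

  truth⁺ : {D : Family (length S)} → subformulas ψ ⊆ₗ S → Sat _≼_ Val D ψ → Derives ψ D
  truth⁻ : {D : Family (length S)} → subformulas ψ ⊆ₗ S → Derives ψ D → Sat _≼_ Val D ψ

  truth⁺ {⊤′}     _   _             = All.universal (λ _ → MI-K H6) _
  truth⁺ {var k}  _   D⊩k           = lower D⊩k
  truth⁺ {φ ∧′ ψ} sub (D⊩φ , D⊩ψ)   =
    All.zipWith (λ (⊢φ , ⊢ψ) → MI-pair ⊢φ ⊢ψ)
                (truth⁺ (sub ∘ there ∘ ∈-++⁺ˡ) D⊩φ , truth⁺ (sub ∘ there ∘ ∈-++⁺ʳ _) D⊩ψ)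
  -- Test the implication at {Γ ∪ {φ}}, a family above D that forces φ.
  truth⁺ {φ ⇒ ψ}  sub D⊩φ⇒ψ = All.tabulate λ {Γ} Γ∈D →
    let m      = sub (there (∈-++⁺ˡ (φ∈subformulas φ)))
        Γ,φ    = insert m Γ ∷ []
        Γ,φ⊩ψ  = D⊩φ⇒ψ Γ,φ (lose Γ∈D (⊆-insert m Γ) ∷ [])
                        (truth⁻ (sub ∘ there ∘ ∈-++⁺ˡ) (⋀-insert-proj m Γ ∷ []))
    in MI-curry (MI-trans (⋀-insert-intro m Γ)
                          (All.head (truth⁺ (sub ∘ there ∘ ∈-++⁺ʳ _) Γ,φ⊩ψ)))

  truth⁻ {⊤′}     _   _   = tt
  truth⁻ {var k}  _   D⊢k = lift D⊢k
  truth⁻ {φ ∧′ ψ} sub D⊢φ∧ψ =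
      truth⁻ (sub ∘ there ∘ ∈-++⁺ˡ) (All.map (λ ⊢ → MI-trans ⊢ (H3 _ _)) D⊢φ∧ψ)
    , truth⁻ (sub ∘ there ∘ ∈-++⁺ʳ _) (All.map (λ ⊢ → MI-trans ⊢ (H4 _ _)) D⊢φ∧ψ)
  truth⁻ {φ ⇒ ψ}  sub D⊢φ⇒ψ E D≼E E⊩φ =
    truth⁻ (sub ∘ there ∘ ∈-++⁺ʳ _)
           (All.zipWith (λ (⊢φ⇒ψ , ⊢φ) → MI-S ⊢φ⇒ψ ⊢φ)
                        (IsFilter.upclosed (Derives-isFilter (φ ⇒ ψ)) D≼E D⊢φ⇒ψ ,
                         truth⁺ (sub ∘ there ∘ ∈-++⁺ˡ) E⊩φ))

  frame : (c ℓ₁ ℓ₂ : Level) → IFrame c ℓ₁ ℓ₂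
  frame c ℓ₁ ℓ₂ = liftIFrame c ℓ₁ ℓ₂ (familyIFrame (length S))

  Val↑ : (c p : Level) → ℕ → Lift c (Family (length S)) → Set p
  Val↑ c p k x = Lift p (Val k (lower x))

  Val↑-isFilter : (c ℓ₁ ℓ₂ p : Level) (k : ℕ) → IsFilter (frame c ℓ₁ ℓ₂) (Val↑ c p k)
  Val↑-isFilter c ℓ₁ ℓ₂ p k = lift-isFilter p (Derives-isFilter (var k))

  root : (c : Level) → Lift c (Family (length S))
  root c = lift (∅ ∷ [])

  root⊩⇒MI : (c ℓ₁ ℓ₂ p : Level) → subformulas φ ⊆ₗ S →
             Sat (IFrame._≤_ (frame c ℓ₁ ℓ₂)) (Val↑ c p) (root c) φ → MI φ
  root⊩⇒MI {φ} c ℓ₁ ℓ₂ p sub root⊩φ =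
    MP (All.head (truth⁺ sub (Sat-lower _≼_ Val c ℓ₂ p φ root⊩φ))) (⋀-∅ S)

  data Term : Set where
    principal : Family (length S) → Term
    letter    : ℕ → Term
    _∩ₜ_ _⇒ₜ_ : Term → Term → Term

  ⟦_⟧ : Term → Family (length S) → Set
  ⟦ principal D ⟧ = D ≼_
  ⟦ letter k ⟧    = Val k
  ⟦ s ∩ₜ t ⟧ E    = ⟦ s ⟧ E × ⟦ t ⟧ E
  ⟦ s ⇒ₜ t ⟧      = _⇛_ (familyIFrame (length S)) ⟦ s ⟧ ⟦ t ⟧

  ⟦⟧-isFilter : ∀ t → IsFilter (familyIFrame (length S)) ⟦ t ⟧
  ⟦⟧-isFilter (principal D) = ↑-isFilter _ D
  ⟦⟧-isFilter (letter k)    = Derives-isFilter (var k)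
  ⟦⟧-isFilter (s ∩ₜ t)      = ∩-isFilter _ (⟦⟧-isFilter s) (⟦⟧-isFilter t)
  ⟦⟧-isFilter (s ⇒ₜ t)      = ⇛-isFilter _ (⟦⟧-isFilter s) (⟦⟧-isFilter t)

  descriptiveFrame : (c ℓ₁ ℓ₂ p a : Level) → DescriptiveIFrame c ℓ₁ ℓ₂ p a
  descriptiveFrame c ℓ₁ ℓ₂ p a = record
    { frame          = frame c ℓ₁ ℓ₂
    ; Idx            = Lift a Term
    ; adm            = adm
    ; adm-filt       = adm-isFilter
    ; closed-∩       = λ i j → lift (lower i ∩ₜ lower j) , λ _ →
        mk⇔ (λ (lift (Ui , Uj)) → lift Ui , lift Uj) (λ (lift Ui , lift Uj) → lift (Ui , Uj))
    ; closed-⇒       = λ i j → lift (lower i ⇒ₜ lower j) , λ _ →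
        mk⇔ (λ (lift h) y (lift x≼y) (lift Ui) → lift (h (lower y) x≼y Ui))
            (λ h → lift λ E D≼E Ui → lower (h (lift E) (lift D≼E) (lift Ui)))
    ; differentiated = λ {x} x⋠y →
        lift (principal (lower x)) , lift ≼-refl , λ (lift x≼y) → x⋠y (lift x≼y)
    ; compact        =
        finite⇒compact (frame c ℓ₁ ℓ₂) adm (λ i → IsFilter.upclosed (adm-isFilter i))
          (map lift (sublists (allSubsets (length S))))
          (λ x → Any.map⁺ (Any.map (λ (E≼D , D≼E) → lift E≼D , lift D≼E)
                                   (family-finite (lower x))))
    }
    where
    adm : Lift a Term → Lift c (Family (length S)) → Set p
    adm i x = Lift p (⟦ lower i ⟧ (lower x))

    adm-isFilter : ∀ i → IsFilter (frame c ℓ₁ ℓ₂) (adm i)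
    adm-isFilter i = lift-isFilter p (⟦⟧-isFilter (lower i))

theorem3p12 : (c ℓ₁ ℓ₂ p a : Level) (φ : Fm) →
    (ValidDescriptive c ℓ₁ ℓ₂ p a φ → MI φ) ×
    (ValidI c ℓ₁ ℓ₂ p φ → MI φ) ×
    (ValidKripke c ℓ₁ ℓ₂ p φ → MI φ)
theorem3p12 c ℓ₁ ℓ₂ p a φ =
    (λ valid → complete (valid (descriptiveFrame c ℓ₁ ℓ₂ p a) (lift ∘ letter) (root c)))
  , (λ valid → complete (valid (frame c ℓ₁ ℓ₂) (Val↑ c p) (Val↑-isFilter c ℓ₁ ℓ₂ p) (root c)))
  , (λ valid → complete (valid (IFrame.poset (frame c ℓ₁ ℓ₂)) (Val↑ c p)
                               (IsFilter.upclosed ∘ Val↑-isFilter c ℓ₁ ℓ₂ p) (root c)))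
  where
  open CanonicalModel (subformulas φ)

  complete : Sat (IFrame._≤_ (frame c ℓ₁ ℓ₂)) (Val↑ c p) (root c) φ → MI φ
  complete = root⊩⇒MI c ℓ₁ ℓ₂ p (λ φ′∈ → φ′∈)
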